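{- Let $i,j,m\in\mathbb{N}$, and let $A=(a_0,\dots,a_i)$ and $B=(b_0,\dots,b_j)$ be finite sequences of positive integers satisfying $m[\widetilde A]=[B]$. Then the concatenation $BA=(b_0,\dots,b_j,a_0,\dots,a_i)$ is an $m$-palindrome if and only if $m[a_i,\dots,a_1]=[b_0,\dots,b_{j-1}]$.
   Context: For a finite sequence $X=(x_0,\dots,x_n)$ of positive integers, $[X]=[x_0,\dots,x_n]$ denotes the value of the finite continued fraction $x_0+\cfrac{1}{x_1+\cfrac{1}{\ddots+\cfrac{1}{x_n}}}$, and $\widetilde X=(x_n,\dots,x_0)$ its reversal. $X$ is an $m$-palindrome ($m\in\mathbb{N}$) if $[X]=m[\widetilde X]$. -}

module Defs where

open import Data.Nat using (ℕ; zero; suc; _+_; _*_; _<_)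
open import Data.Product using (_×_; _,_; proj₁; proj₂)
open import Data.Vec using (Vec; []; _∷_; _++_)
open import Data.Vec.Relation.Unary.All using (All)
open import Relation.Binary.PropositionalEquality using (_≡_)

-- A continued fraction [x_0,...,x_n] is represented projectively by the
-- pair (p , q) with [x_0,...,x_n] = p / q  (standard continuant recursion):
--   [] = 1/0 = ∞   (usual convention for the empty continued fraction)
--   [x , X] = x + 1/[X] = (x * p + q) / p   where [X] = p / q.
cf : ∀ {n} → Vec ℕ n → ℕ × ℕ
cf [] = 1 , 0
cf (x ∷ xs) = x * proj₁ (cf xs) + proj₂ (cf xs) , proj₁ (cf xs)

num den : ∀ {n} → Vec ℕ n → ℕ
num X = proj₁ (cf X)
den X = proj₂ (cf X)

_⊙_≐_ : ∀ {n k} → ℕ → Vec ℕ n → Vec ℕ k → Set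
m ⊙ X ≐ Y = m * num X * den Y ≡ num Y * den X

Positive : ∀ {n} → Vec ℕ n → Set
Positive = All (λ x → 0 < x)

IsPalindrome : ∀ {n} → ℕ → Vec ℕ n → Set
IsPalindrome m X = m ⊙ Data.Vec.reverse X ≐ X

module Submission where

open import Defs
open import Data.Nat using (ℕ; suc; s≤s; z≤n; _+_; _*_; _<_; NonZero; >-nonZero)
open import Data.Nat.Properties
  using (*-identityˡ; +-cancelˡ-≡; *-cancelˡ-≡; *-mono-<; <-≤-trans; m≤m+n)
open import Data.Nat.Tactic.RingSolver using (solve-∀)
open import Data.Vec using (Vec; []; _∷_; _++_; _∷ʳ_; reverse; tail; init; initLast)
open import Data.Vec.Properties using (reverse-∷)
open import Data.Vec.Relation.Unary.All using ([]; _∷_)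
open import Data.Vec.Relation.Unary.All.Properties using (++⁺)
open import Data.Product using (_,_)
open import Function using (id)
open import Function.Bundles using (_⇔_; mk⇔)
open import Function.Properties.Equivalence using (⇔-setoid)
open import Level using (0ℓ)
import Relation.Binary.Reasoning.Setoid as SetoidReasoning
open import Relation.Binary.PropositionalEquality

-- The continued fraction [x₀, …, xₙ] is m₁₁ / m₂₁ of the product of the symmetric
-- matrices (xₖ 1 ∣ 1 0), and reversing the sequence transposes the product, so
-- [X̃] = m₁₁ / m₁₂.  With P, Q the products for B, A, the sequence BA is an
-- m-palindrome iff m (PQ)₁₁ (PQ)₂₁ = (PQ)₁₁ (PQ)₁₂.  Cancelling the positive factor
-- (PQ)₁₁ and then the terms m Q₁₁ P₂₁ = P₁₁ Q₁₂ (the hypothesis m[Ã] = [B]) leaves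
-- m Q₂₁ P₂₂ = P₁₂ Q₂₂; the second row of Q and the second column of P are the first
-- row of the product for tail A and the first column of the product for init B.

record Mat₂ : Set where
  constructor mat
  field
    m₁₁ m₁₂ m₂₁ m₂₂ : ℕ

open Mat₂

infixl 7 _·_
infix 8 _ᵀ

_·_ : Mat₂ → Mat₂ → Mat₂
mat a b c d · mat a′ b′ c′ d′ =
  mat (a * a′ + b * c′) (a * b′ + b * d′) (c * a′ + d * c′) (c * b′ + d * d′)

_ᵀ : Mat₂ → Mat₂
mat a b c d ᵀ = mat a c b d

I : Mat₂
I = mat 1 0 0 1

step : ℕ → Mat₂
step x = mat x 1 1 0

mat-cong : ∀ {a b c d a′ b′ c′ d′} →
  a ≡ a′ → b ≡ b′ → c ≡ c′ → d ≡ d′ → mat a b c d ≡ mat a′ b′ c′ d′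
mat-cong refl refl refl refl = refl

·-assoc : ∀ P Q R → (P · Q) · R ≡ P · (Q · R)
·-assoc (mat a b c d) (mat e f g h) (mat p q r s) =
  mat-cong (entry a b e f g h p r) (entry a b e f g h q s)
           (entry c d e f g h p r) (entry c d e f g h q s)
  where
  entry : ∀ a b e f g h p r →
    (a * e + b * g) * p + (a * f + b * h) * r ≡ a * (e * p + f * r) + b * (g * p + h * r)
  entry = solve-∀

·-identityˡ : ∀ P → I · P ≡ P
·-identityˡ (mat a b c d) = mat-cong (entry a c) (entry b d) (entry′ a c) (entry′ b d)
  where
  entry : ∀ a c → 1 * a + 0 * c ≡ a
  entry = solve-∀
  entry′ : ∀ a c → 0 * a + 1 * c ≡ c
  entry′ = solve-∀

·-identityʳ : ∀ P → P · I ≡ P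
·-identityʳ (mat a b c d) = mat-cong (entry a b) (entry′ a b) (entry c d) (entry′ c d)
  where
  entry : ∀ a b → a * 1 + b * 0 ≡ a
  entry = solve-∀
  entry′ : ∀ a b → a * 0 + b * 1 ≡ b
  entry′ = solve-∀

ᵀ-· : ∀ P Q → (P · Q) ᵀ ≡ Q ᵀ · P ᵀ
ᵀ-· (mat a b c d) (mat e f g h) =
  mat-cong (entry a b e g) (entry c d e g) (entry a b f h) (entry c d f h)
  where
  entry : ∀ a b e g → a * e + b * g ≡ e * a + g * b
  entry = solve-∀

1*a+0*b≡a : ∀ a b → 1 * a + 0 * b ≡ a
1*a+0*b≡a = solve-∀

a*1+b*0≡a : ∀ a b → a * 1 + b * 0 ≡ a
a*1+b*0≡a = solve-∀

m₂₁-step-· : ∀ x Q → m₂₁ (step x · Q) ≡ m₁₁ Q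
m₂₁-step-· x Q = 1*a+0*b≡a (m₁₁ Q) (m₂₁ Q)

m₂₂-step-· : ∀ x Q → m₂₂ (step x · Q) ≡ m₁₂ Q
m₂₂-step-· x Q = 1*a+0*b≡a (m₁₂ Q) (m₂₂ Q)

m₁₂-·-step : ∀ P y → m₁₂ (P · step y) ≡ m₁₁ P
m₁₂-·-step P y = a*1+b*0≡a (m₁₁ P) (m₁₂ P)

m₂₂-·-step : ∀ P y → m₂₂ (P · step y) ≡ m₂₁ P
m₂₂-·-step P y = a*1+b*0≡a (m₂₁ P) (m₂₂ P)

continuant : ∀ {n} → Vec ℕ n → Mat₂
continuant [] = I
continuant (x ∷ X) = step x · continuant X

cf-continuant : ∀ {n} (X : Vec ℕ n) → cf X ≡ (m₁₁ (continuant X) , m₂₁ (continuant X))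
cf-continuant [] = refl
cf-continuant (x ∷ X) rewrite cf-continuant X =
  cong₂ _,_ (cong (x * p +_) (sym (*-identityˡ q))) (sym (1*a+0*b≡a p q))
  where
  p q : ℕ
  p = m₁₁ (continuant X)
  q = m₂₁ (continuant X)

continuant-++ : ∀ {n k} (X : Vec ℕ n) (Y : Vec ℕ k) →
  continuant (X ++ Y) ≡ continuant X · continuant Y
continuant-++ [] Y = sym (·-identityˡ (continuant Y))
continuant-++ (x ∷ X) Y = begin
  step x · continuant (X ++ Y)              ≡⟨ cong (step x ·_) (continuant-++ X Y) ⟩
  step x · (continuant X · continuant Y)    ≡⟨ sym (·-assoc (step x) _ _) ⟩
  step x · continuant X · continuant Y      ∎
  where open ≡-Reasoning

continuant-∷ʳ : ∀ {n} (X : Vec ℕ n) y → continuant (X ∷ʳ y) ≡ continuant X · step y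
continuant-∷ʳ [] y = trans (·-identityʳ (step y)) (sym (·-identityˡ (step y)))
continuant-∷ʳ (x ∷ X) y = begin
  step x · continuant (X ∷ʳ y)              ≡⟨ cong (step x ·_) (continuant-∷ʳ X y) ⟩
  step x · (continuant X · step y)          ≡⟨ sym (·-assoc (step x) _ _) ⟩
  step x · continuant X · step y            ∎
  where open ≡-Reasoning

continuant-reverse : ∀ {n} (X : Vec ℕ n) → continuant (reverse X) ≡ continuant X ᵀ
continuant-reverse [] = refl
continuant-reverse (x ∷ X) = begin
  continuant (reverse (x ∷ X))              ≡⟨ cong continuant (reverse-∷ x X) ⟩
  continuant (reverse X ∷ʳ x)               ≡⟨ continuant-∷ʳ (reverse X) x ⟩
  continuant (reverse X) · step x           ≡⟨ cong (_· step x) (continuant-reverse X) ⟩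
  continuant X ᵀ · step x ᵀ                 ≡⟨ sym (ᵀ-· (step x) (continuant X)) ⟩
  (step x · continuant X) ᵀ                 ∎
  where open ≡-Reasoning

positive⇒m₁₁-continuant>0 : ∀ {n} (X : Vec ℕ n) → Positive X → 0 < m₁₁ (continuant X)
positive⇒m₁₁-continuant>0 [] [] = s≤s z≤n
positive⇒m₁₁-continuant>0 (x ∷ X) (x>0 ∷ X>0) =
  <-≤-trans (*-mono-< x>0 (positive⇒m₁₁-continuant>0 X X>0)) (m≤m+n _ _)

infix 4 _⊙_≐ₘ_

_⊙_≐ₘ_ : ℕ → Mat₂ → Mat₂ → Set
m ⊙ P ≐ₘ Q = m * m₁₁ P * m₂₁ Q ≡ m₁₁ Q * m₂₁ P

⊙≐-continuant : ∀ {n k} m (X : Vec ℕ n) (Y : Vec ℕ k) →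
  (m ⊙ X ≐ Y) ≡ (m ⊙ continuant X ≐ₘ continuant Y)
⊙≐-continuant m X Y rewrite cf-continuant X | cf-continuant Y = refl

⊙≐-reverse : ∀ {n k} m (X : Vec ℕ n) (Y : Vec ℕ k) →
  (m ⊙ reverse X ≐ Y) ≡ (m ⊙ continuant X ᵀ ≐ₘ continuant Y)
⊙≐-reverse m X Y =
  trans (⊙≐-continuant m (reverse X) Y) (cong (m ⊙_≐ₘ continuant Y) (continuant-reverse X))

*-cancelˡ-⇔ : ∀ n {u v} .{{_ : NonZero n}} → (n * u ≡ n * v) ⇔ (u ≡ v)
*-cancelˡ-⇔ n = mk⇔ (*-cancelˡ-≡ _ _ n) (cong (n *_))

+-cancel-⇔ : ∀ {x y u v} → x ≡ y → (x + u ≡ y + v) ⇔ (u ≡ v)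
+-cancel-⇔ {x} refl = mk⇔ (+-cancelˡ-≡ x _ _) (cong (x +_))

palindrome-·-⇔ : ∀ m P Q → 0 < m₁₁ (P · Q) → m ⊙ Q ᵀ ≐ₘ P →
  (m ⊙ (P · Q) ᵀ ≐ₘ P · Q) ⇔ (m * m₂₁ Q * m₂₂ P ≡ m₁₂ P * m₂₂ Q)
palindrome-·-⇔ m (mat b b′ d d′) (mat a a′ c c′) N>0 mad≡ba′ = begin
  m * N * (d * a + d′ * c) ≡ N * (b * a′ + b′ * c′)
    ≡⟨ cong (_≡ N * (b * a′ + b′ * c′)) (rearrange m a b b′ c d d′) ⟩
  N * (m * a * d + m * c * d′) ≡ N * (b * a′ + b′ * c′)  ≈⟨ *-cancelˡ-⇔ N ⟩
  m * a * d + m * c * d′ ≡ b * a′ + b′ * c′              ≈⟨ +-cancel-⇔ mad≡ba′ ⟩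
  m * c * d′ ≡ b′ * c′                                   ∎
  where
  open SetoidReasoning (⇔-setoid 0ℓ)
  N : ℕ
  N = b * a + b′ * c
  instance
    N≢0 : NonZero N
    N≢0 = >-nonZero N>0
  rearrange : ∀ m a b b′ c d d′ →
    m * (b * a + b′ * c) * (d * a + d′ * c) ≡ (b * a + b′ * c) * (m * a * d + m * c * d′)
  rearrange = solve-∀

lemma3p4 : (i j m : ℕ) (A : Vec ℕ (suc i)) (B : Vec ℕ (suc j)) →
    Positive A → Positive B →
    m ⊙ reverse A ≐ B →
    (IsPalindrome m (B ++ A) ⇔ (m ⊙ reverse (tail A) ≐ init B))
lemma3p4 i j m A@(x ∷ A₀) B A>0 B>0 h with initLast B
... | B₀ , y , refl = begin
  IsPalindrome m (B ++ A)                             ≡⟨ ⊙≐-reverse m (B ++ A) (B ++ A) ⟩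
  m ⊙ continuant (B ++ A) ᵀ ≐ₘ continuant (B ++ A)    ≡⟨ cong (λ M → m ⊙ M ᵀ ≐ₘ M) continuant-BA ⟩
  m ⊙ (P · Q) ᵀ ≐ₘ P · Q                              ≈⟨ palindrome-·-⇔ m P Q PQ₁₁>0 h′ ⟩
  m * m₂₁ Q * m₂₂ P ≡ m₁₂ P * m₂₂ Q                   ≡⟨ strip-steps ⟩
  m ⊙ Q₀ ᵀ ≐ₘ P₀                                      ≡⟨ sym (⊙≐-reverse m A₀ B₀) ⟩
  m ⊙ reverse A₀ ≐ B₀                                 ∎
  where
  open SetoidReasoning (⇔-setoid 0ℓ)
  P₀ Q₀ P Q : Mat₂
  P₀ = continuant B₀
  Q₀ = continuant A₀
  P = P₀ · step y
  Q = step x · Q₀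
  continuant-B : continuant B ≡ P
  continuant-B = continuant-∷ʳ B₀ y
  continuant-BA : continuant (B ++ A) ≡ P · Q
  continuant-BA = trans (continuant-++ B A) (cong (_· Q) continuant-B)
  PQ₁₁>0 : 0 < m₁₁ (P · Q)
  PQ₁₁>0 = subst (λ M → 0 < m₁₁ M) continuant-BA
    (positive⇒m₁₁-continuant>0 (B ++ A) (++⁺ B>0 A>0))
  h′ : m ⊙ Q ᵀ ≐ₘ P
  h′ = subst id (trans (⊙≐-reverse m A B) (cong (m ⊙ Q ᵀ ≐ₘ_) continuant-B)) h
  strip-steps : (m * m₂₁ Q * m₂₂ P ≡ m₁₂ P * m₂₂ Q) ≡ (m ⊙ Q₀ ᵀ ≐ₘ P₀)
  strip-steps = cong₂ _≡_
    (cong₂ (λ u v → m * u * v) (m₂₁-step-· x Q₀) (m₂₂-·-step P₀ y))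
    (cong₂ _*_ (m₁₂-·-step P₀ y) (m₂₂-step-· x Q₀))
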